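{- Let $G$ be a finite connected graph with chromatic number $\chi$, let $c$ be a nice $\chi$-coloring of $G$, and let $(V^c_1,\dots,V^c_k)$ be the level partition of $D_c$. Let $B_c$ be the set of vertices $x$ of $G$ for which there is no path $x=x_1x_2\cdots x_\chi$ in $G$ on $\chi$ distinct vertices whose colors $c(x_1),\dots,c(x_\chi)$ are pairwise distinct. Then $B_c\subseteq V^c_2\cup V^c_3\cup\dots\cup V^c_{\chi-1}$.
   Context: A proper $\chi$-coloring of $G$ is a map $c:V(G)\to\{1,\dots,\chi\}$ with $c(u)\ne c(v)$ for adjacent $u,v$; colors are considered modulo $\chi$. For such $c$, $D_c$ is the oriented graph on $V(G)$ in which $ab$ is an arc iff $\{a,b\}\in E(G)$ and $c(b)\equiv c(a)+1\pmod{\chi}$. The coloring $c$ is nice if $D_c$ is acyclic with exactly one sink. For an acyclic oriented graph $D$, its level partition $(V_1,\dots,V_k)$ is defined by letting $V_i$ be the set of sinks of the oriented subgraph of $D$ induced on $V(D)\setminus(V_1\cup\dots\cup V_{i-1})$, until all vertices are used. -}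

module Defs where

open import Data.Nat using (ℕ; zero; suc; _<_; _≤_)
open import Data.Fin using (Fin; toℕ)
open import Data.Bool using (Bool; true; false)
open import Data.Product using (Σ; ∃; ∃-syntax; _×_; _,_)
open import Data.Sum using (_⊎_)
open import Data.Empty using (⊥)
open import Relation.Nullary using (¬_)
open import Relation.Binary.PropositionalEquality using (_≡_)
open import Relation.Binary.Construct.Closure.ReflexiveTransitive using (Star)
open import Relation.Binary.Construct.Closure.Transitive using (TransClosure)
open import Function.Definitions using (Injective)
open import Function using (_∘_)

record Graph : Set where
  field
    n     : ℕ
    adj   : Fin n → Fin n → Bool
    sym   : ∀ u v → adj u v ≡ adj v u
    irrfl : ∀ v → adj v v ≡ false

module _ (G : Graph) where
  open Graph G

  V : Set
  V = Fin n

  Adj : V → V → Set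
  Adj u v = adj u v ≡ true

  Connected : Set
  Connected = ∀ u v → Star Adj u v

  -- proper k-coloring; colors are 0,…,k-1 (= 1,…,k shifted), considered mod k
  Proper : (k : ℕ) → (V → Fin k) → Set
  Proper k c = ∀ u v → Adj u v → ¬ (c u ≡ c v)

  Colorable : ℕ → Set
  Colorable k = Σ (V → Fin k) (Proper k)

  IsChromaticNumber : ℕ → Set
  IsChromaticNumber χ = Colorable χ × (∀ m → m < χ → ¬ Colorable m)

  module _ (χ : ℕ) (c : V → Fin χ) where
    -- c(b) ≡ c(a) + 1 (mod χ), for colors in {0,…,χ-1}
    SuccMod : V → V → Set
    SuccMod a b = (toℕ (c b) ≡ suc (toℕ (c a))) ⊎ (suc (toℕ (c a)) ≡ χ × toℕ (c b) ≡ 0)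

    Arc : V → V → Set
    Arc a b = Adj a b × SuccMod a b

    Acyclic : Set
    Acyclic = ∀ a → ¬ TransClosure Arc a a

    Sink : V → Set
    Sink a = ∀ b → ¬ Arc a b

    Nice : Set
    Nice = Proper χ c × Acyclic × (∃[ s ] (Sink s × (∀ t → Sink t → t ≡ s)))

    -- Below i v : v ∈ V₁ ∪ … ∪ Vᵢ  (level partition of D_c)
    Below : ℕ → V → Set
    Below zero v = ⊥
    Below (suc i) v = Below i v ⊎ (¬ Below i v × (∀ w → Arc v w → Below i w))

    -- InLevel i v : v ∈ Vᵢ (levels indexed from 1)
    InLevel : ℕ → V → Set
    InLevel zero v = ⊥
    InLevel (suc i) v = ¬ Below i v × (∀ w → Arc v w → Below i w)

    RainbowPathFrom : V → Set
    RainbowPathFrom x =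
      Σ (Fin χ → V) λ p →
        Injective _≡_ _≡_ p ×
        Injective _≡_ _≡_ (c ∘ p) ×
        (∀ i j → toℕ j ≡ suc (toℕ i) → Adj (p i) (p j)) ×
        (∀ i → toℕ i ≡ 0 → p i ≡ x)

    InB : V → Set
    InB x = ¬ RainbowPathFrom x

-- Colours increase by one (mod χ) along every arc of D_c, so a directed path on at
-- most χ vertices is rainbow, and by acyclicity it has no repeated vertex.  A vertex
-- of level i starts a directed path on i vertices, hence levels ≥ χ are excluded.  The
-- first level is the unique sink s; every vertex flows down to s, and starting from a
-- vertex coloured c(s) + 1 (it exists since χ is minimal) the path to s has length
-- ≡ −1 (mod χ), so its last χ vertices, read backwards, form a rainbow path from s.
module Submission where

open import Defs
open import Data.Nat using (ℕ; zero; suc; _≤_; _<_; _∸_; _+_; _*_; _/_; _%_; z≤n; s≤s; NonZero; _≟_; _≤?_)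
open import Data.Nat.Properties
open import Data.Nat.DivMod
open import Data.Nat.Divisibility using (_∣_; divides; ∣⇒≤; n∣m⇒m%n≡0)
open import Data.Fin using (Fin; toℕ; fromℕ<; punchOut)
import Data.Fin.Properties as Fin
open import Data.Bool using (true) renaming (_≟_ to _≟ᵇ_)
open import Data.Product using (∃-syntax; ∃₂; _×_; _,_; proj₁; proj₂)
open import Data.Sum using (inj₁; inj₂)
open import Data.Empty using (⊥-elim)
open import Function using (_∘_)
open import Relation.Nullary using (Dec; yes; no; ¬_)
open import Relation.Nullary.Decidable using (_×-dec_; _⊎-dec_; _→-dec_; ¬?; decidable-stable)
open import Relation.Binary.PropositionalEquality
open import Relation.Binary.Definitions using (tri<; tri≈; tri>)
open import Relation.Binary.Construct.Closure.Transitive using (TransClosure; [_]; _∷ʳ_)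

[m%n+o]%n≡[m+o]%n : ∀ m o n .{{_ : NonZero n}} → (m % n + o) % n ≡ (m + o) % n
[m%n+o]%n≡[m+o]%n m o n = begin
  (m % n + o) % n         ≡⟨ %-distribˡ-+ (m % n) o n ⟩
  (m % n % n + o % n) % n ≡⟨ cong (λ r → (r + o % n) % n) (m%n%n≡m%n m n) ⟩
  (m % n + o % n) % n     ≡⟨ %-distribˡ-+ m o n ⟨
  (m + o) % n             ∎
  where open ≡-Reasoning

[m+o]%n≡m%n⇒n∣o : ∀ m o n .{{_ : NonZero n}} → (m + o) % n ≡ m % n → n ∣ o
[m+o]%n≡m%n⇒n∣o m o n eq = divides ((m + o) / n ∸ m / n) (begin
  o                                                 ≡⟨ m+n∸m≡n m o ⟨
  (m + o) ∸ m                                       ≡⟨ cong₂ _∸_ m+o-divmod (m≡m%n+[m/n]*n m n) ⟩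
  (m % n + ((m + o) / n) * n) ∸ (m % n + (m / n) * n) ≡⟨ [m+n]∸[m+o]≡n∸o (m % n) _ _ ⟩
  ((m + o) / n) * n ∸ (m / n) * n                   ≡⟨ *-distribʳ-∸ n ((m + o) / n) (m / n) ⟨
  ((m + o) / n ∸ m / n) * n                         ∎)
  where
  open ≡-Reasoning
  m+o-divmod : m + o ≡ m % n + ((m + o) / n) * n
  m+o-divmod = trans (m≡m%n+[m/n]*n (m + o) n) (cong (_+ ((m + o) / n) * n) eq)

≤-+-%-injectiveʳ : ∀ m {k l n} .{{_ : NonZero n}} → k ≤ l → l < n → (m + k) % n ≡ (m + l) % n → k ≡ l
≤-+-%-injectiveʳ m {k} {l} {n} k≤l l<n eq = begin
  k           ≡⟨ +-identityʳ k ⟨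
  k + 0       ≡⟨ cong (k +_) gap≡0 ⟨
  k + (l ∸ k) ≡⟨ m+[n∸m]≡n k≤l ⟩
  l           ∎
  where
  open ≡-Reasoning
  n∣gap : n ∣ l ∸ k
  n∣gap = [m+o]%n≡m%n⇒n∣o (m + k) (l ∸ k) n
    (trans (cong (_% n) (trans (+-assoc m k (l ∸ k)) (cong (m +_) (m+[n∸m]≡n k≤l)))) (sym eq))
  gap≡0 : l ∸ k ≡ 0
  gap≡0 = trans (sym (m<n⇒m%n≡m (≤-<-trans (m∸n≤m l k) l<n))) (n∣m⇒m%n≡0 (l ∸ k) n n∣gap)

+-%-injectiveʳ : ∀ m {k l n} .{{_ : NonZero n}} → k < n → l < n → (m + k) % n ≡ (m + l) % n → k ≡ l
+-%-injectiveʳ m {k} {l} k<n l<n eq with ≤-total k l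
... | inj₁ k≤l = ≤-+-%-injectiveʳ m k≤l l<n eq
... | inj₂ l≤k = sym (≤-+-%-injectiveʳ m l≤k k<n (sym eq))

InjectiveUpTo : ∀ {a} {A : Set a} → ℕ → (ℕ → A) → Set a
InjectiveUpTo m f = ∀ {k l} → k ≤ m → l ≤ m → f k ≡ f l → k ≡ l

injectiveUpTo-∸ : ∀ {a} {A : Set a} {m} {f : ℕ → A} → InjectiveUpTo m f → InjectiveUpTo m (f ∘ (m ∸_))
injectiveUpTo-∸ {m = m} f-inj {k} {l} k≤m l≤m eq = ∸-cancelˡ-≡ k≤m l≤m (f-inj (m∸n≤m m k) (m∸n≤m m l) eq)

module _ (G : Graph) {χ′ : ℕ} (c : V G → Fin (suc χ′)) where
  private
    χ : ℕ
    χ = suc χ′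

  adj-sym : ∀ {u v} → Adj G u v → Adj G v u
  adj-sym {u} {v} uv = trans (Graph.sym G v u) uv

  arc? : ∀ a b → Dec (Arc G χ c a b)
  arc? a b = (Graph.adj G a b ≟ᵇ true)
    ×-dec ((toℕ (c b) ≟ suc (toℕ (c a))) ⊎-dec ((suc (toℕ (c a)) ≟ χ) ×-dec (toℕ (c b) ≟ 0)))

  below? : ∀ i v → Dec (Below G χ c i v)
  below? zero    v = no λ ()
  below? (suc i) v = below? i v ⊎-dec (¬? (below? i v) ×-dec Fin.all? λ w → arc? v w →-dec below? i w)

  below⇒inLevel : ∀ i v → Below G χ c i v → ∃[ j ] InLevel G χ c j v
  below⇒inLevel (suc i) v (inj₁ v∈V≤i) = below⇒inLevel i v v∈V≤i
  below⇒inLevel (suc i) v (inj₂ v∈Vi+1) = suc i , v∈Vi+1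

  arc⇒colour-suc : ∀ {a b} → Arc G χ c a b → toℕ (c b) ≡ suc (toℕ (c a)) % χ
  arc⇒colour-suc {b = b} (_ , inj₁ cb≡1+ca) =
    trans cb≡1+ca (sym (m<n⇒m%n≡m (subst (_< χ) cb≡1+ca (Fin.toℕ<n (c b)))))
  arc⇒colour-suc (_ , inj₂ (1+ca≡χ , cb≡0)) =
    trans cb≡0 (sym (trans (cong (_% χ) 1+ca≡χ) (n%n≡0 χ)))

  -- A directed path of D_c with m arcs; only the values p 0, …, p m matter.
  record IsDiPath (m : ℕ) (p : ℕ → V G) : Set where
    constructor dipath
    field step : ∀ {k} → k < m → Arc G χ c (p k) (p (suc k))
  open IsDiPath

  _◂_ : V G → (ℕ → V G) → ℕ → V G
  (v ◂ p) zero    = v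
  (v ◂ p) (suc k) = p k

  ◂-dipath : ∀ {v m p} → Arc G χ c v (p 0) → IsDiPath m p → IsDiPath (suc m) (v ◂ p)
  ◂-dipath v→p0 dp = dipath λ { {zero} _ → v→p0 ; {suc k} (s≤s k<m) → step dp k<m }

  dipath-take : ∀ {j m p} → j ≤ m → IsDiPath m p → IsDiPath j p
  dipath-take j≤m dp = dipath λ k<j → step dp (≤-trans k<j j≤m)

  dipath-drop : ∀ d {j p} → IsDiPath (d + j) p → IsDiPath j (λ k → p (d + k))
  dipath-drop d {j} {p} dp = dipath λ {k} k<j →
    subst (λ l → Arc G χ c (p (d + k)) (p l)) (sym (+-suc d k))
      (step dp (subst (_≤ d + j) (+-suc d k) (+-monoʳ-≤ d k<j)))

  dipath-colour : ∀ {m p} → IsDiPath m p → ∀ k → k ≤ m → toℕ (c (p k)) ≡ (toℕ (c (p 0)) + k) % χ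
  dipath-colour {p = p} _ zero _ =
    sym (trans (cong (_% χ) (+-identityʳ (toℕ (c (p 0))))) (m<n⇒m%n≡m (Fin.toℕ<n (c (p 0)))))
  dipath-colour {p = p} dp (suc k) k<m = begin
    toℕ (c (p (suc k)))     ≡⟨ arc⇒colour-suc (step dp k<m) ⟩
    suc (toℕ (c (p k))) % χ ≡⟨ cong (λ r → suc r % χ) (dipath-colour dp k (<⇒≤ k<m)) ⟩
    suc ((a + k) % χ) % χ   ≡⟨ cong (_% χ) (+-comm 1 _) ⟩
    ((a + k) % χ + 1) % χ   ≡⟨ [m%n+o]%n≡[m+o]%n (a + k) 1 χ ⟩
    (a + k + 1) % χ         ≡⟨ cong (_% χ) (+-assoc a k 1) ⟩
    (a + (k + 1)) % χ       ≡⟨ cong (λ r → (a + r) % χ) (+-comm k 1) ⟩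
    (a + suc k) % χ         ∎
    where
    open ≡-Reasoning
    a : ℕ
    a = toℕ (c (p 0))

  dipath-colour-injective : ∀ {m p} → IsDiPath m p → m ≤ χ′ → InjectiveUpTo m (c ∘ p)
  dipath-colour-injective {p = p} dp m≤χ′ {k} {l} k≤m l≤m ck≡cl =
    +-%-injectiveʳ (toℕ (c (p 0))) (s≤s (≤-trans k≤m m≤χ′)) (s≤s (≤-trans l≤m m≤χ′))
      (trans (sym (dipath-colour dp k k≤m)) (trans (cong toℕ ck≡cl) (dipath-colour dp l l≤m)))

  dipath-length : ∀ {m p} → IsDiPath m p → toℕ (c (p 0)) ≡ suc (toℕ (c (p m))) % χ → χ ∣ suc m
  dipath-length {m} {p} dp start = [m+o]%n≡m%n⇒n∣o e (suc m) χ (begin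
    (e + suc m) % χ           ≡⟨ cong (_% χ) (+-suc e m) ⟩
    (suc e + m) % χ           ≡⟨ [m%n+o]%n≡[m+o]%n (suc e) m χ ⟨
    (suc e % χ + m) % χ       ≡⟨ cong (λ r → (r + m) % χ) start ⟨
    (toℕ (c (p 0)) + m) % χ   ≡⟨ dipath-colour dp m ≤-refl ⟨
    e                         ≡⟨ m<n⇒m%n≡m (Fin.toℕ<n (c (p m))) ⟨
    e % χ                     ∎)
    where
    open ≡-Reasoning
    e : ℕ
    e = toℕ (c (p m))

  ¬below⇒dipath : ∀ j v → ¬ Below G χ c j v → ∃[ p ] IsDiPath j (v ◂ p)
  ¬below⇒dipath zero    v _   = (λ _ → v) , dipath λ ()
  ¬below⇒dipath (suc j) v v∉ with Fin.any? (λ w → arc? v w ×-dec ¬? (below? j w))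
  ... | yes (w , v→w , w∉) = let p , dp = ¬below⇒dipath j w w∉ in w ◂ p , ◂-dipath v→w dp
  ... | no ¬escape = ⊥-elim (v∉ (inj₂ (v∉ ∘ inj₁ , λ w v→w →
          decidable-stable (below? j w) λ w∉ → ¬escape (w , v→w , w∉))))

  below⇒dipath-to-sink : ∀ {s} → (∀ t → Sink G χ c t → t ≡ s) →
    ∀ i v → Below G χ c i v → ∃₂ λ m p → IsDiPath m (v ◂ p) × (v ◂ p) m ≡ s
  below⇒dipath-to-sink unique (suc i) v (inj₁ v∈V≤i) = below⇒dipath-to-sink unique i v v∈V≤i
  below⇒dipath-to-sink unique (suc i) v (inj₂ (_ , down)) with Fin.any? (arc? v)
  ... | no ¬arc = 0 , (λ _ → v) , dipath (λ ()) , unique v λ w v→w → ¬arc (w , v→w)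
  ... | yes (w , v→w) =
    let m , p , dp , end = below⇒dipath-to-sink unique i w (down w v→w)
    in suc m , w ◂ p , ◂-dipath v→w dp , end

  rainbow-path : ∀ (p : ℕ → V G) → InjectiveUpTo χ′ p → InjectiveUpTo χ′ (c ∘ p) →
    (∀ {k} → k < χ′ → Adj G (p k) (p (suc k))) → RainbowPathFrom G χ c (p 0)
  rainbow-path p p-inj cp-inj adjacent =
      p ∘ toℕ
    , (λ {i} {j} e → Fin.toℕ-injective (p-inj (bound i) (bound j) e))
    , (λ {i} {j} e → Fin.toℕ-injective (cp-inj (bound i) (bound j) e))
    , (λ i j j≡1+i → subst (λ l → Adj G (p (toℕ i)) (p l)) (sym j≡1+i)
                       (adjacent (subst (_≤ χ′) j≡1+i (bound j))))
    , λ i i≡0 → cong p i≡0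
    where
    bound : (i : Fin χ) → toℕ i ≤ χ′
    bound i = ≤-pred (Fin.toℕ<n i)

  adjacent-reverse : ∀ {m} (p : ℕ → V G) → (∀ {k} → k < m → Adj G (p k) (p (suc k))) →
    ∀ {k} → k < m → Adj G (p (m ∸ k)) (p (m ∸ suc k))
  adjacent-reverse {m} p adjacent {k} k<m =
    subst (λ l → Adj G (p l) (p (m ∸ suc k))) (sym (+-∸-assoc 1 k<m))
      (adj-sym (adjacent {m ∸ suc k} (∸-monoʳ-< (s≤s z≤n) k<m)))

  colour-surjective : Proper G χ c → (∀ m → m < χ → ¬ Colorable G m) → ∀ t → ∃[ u ] c u ≡ t
  colour-surjective proper minimal t with Fin.any? (λ u → c u Fin.≟ t)
  ... | yes hit = hit
  ... | no miss = ⊥-elim (minimal χ′ ≤-refl (c′ , c′-proper))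
    where
    avoids : ∀ u → t ≢ c u
    avoids u t≡cu = miss (u , sym t≡cu)
    c′ : V G → Fin χ′
    c′ u = punchOut (avoids u)
    c′-proper : Proper G χ′ c′
    c′-proper u v uv = proper u v uv ∘ Fin.punchOut-injective (avoids u) (avoids v)

  module _ (acyclic : Acyclic G χ c) where

    dipath⇒⁺ : ∀ {m p k l} → IsDiPath m p → k < l → l ≤ m → TransClosure (Arc G χ c) (p k) (p l)
    dipath⇒⁺ {l = suc l} dp (s≤s k≤l) l<m with m≤n⇒m<n∨m≡n k≤l
    ... | inj₁ k<l  = dipath⇒⁺ dp k<l (<⇒≤ l<m) ∷ʳ step dp l<m
    ... | inj₂ refl = [ step dp l<m ]

    dipath-no-return : ∀ {m p k l} → IsDiPath m p → k < l → l ≤ m → p k ≢ p l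
    dipath-no-return {p = p} {k} dp k<l l≤m pk≡pl =
      acyclic (p k) (subst (TransClosure _ (p k)) (sym pk≡pl) (dipath⇒⁺ dp k<l l≤m))

    dipath-injective : ∀ {m p} → IsDiPath m p → InjectiveUpTo m p
    dipath-injective dp {k} {l} k≤m l≤m pk≡pl with <-cmp k l
    ... | tri< k<l _ _ = ⊥-elim (dipath-no-return dp k<l l≤m pk≡pl)
    ... | tri≈ _ k≡l _ = k≡l
    ... | tri> _ _ l<k = ⊥-elim (dipath-no-return dp l<k k≤m (sym pk≡pl))

    below-n : ∀ v → Below G χ c (Graph.n G) v
    below-n v with below? (Graph.n G) v
    ... | yes v∈V≤n = v∈V≤n
    ... | no v∉ with ¬below⇒dipath _ v v∉
    ...   | p , dp with Fin.pigeonhole (n<1+n (Graph.n G)) ((v ◂ p) ∘ toℕ)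
    ...     | i , j , i<j , same = ⊥-elim (dipath-no-return dp i<j (≤-pred (Fin.toℕ<n j)) same)

    dipath⇒rainbow-from-start : ∀ {p} → IsDiPath χ′ p → RainbowPathFrom G χ c (p 0)
    dipath⇒rainbow-from-start {p} dp =
      rainbow-path p (dipath-injective dp) (dipath-colour-injective dp ≤-refl) (λ k<χ′ → proj₁ (step dp k<χ′))

    dipath⇒rainbow-from-end : ∀ {p} → IsDiPath χ′ p → RainbowPathFrom G χ c (p χ′)
    dipath⇒rainbow-from-end {p} dp =
      rainbow-path (p ∘ (χ′ ∸_)) (injectiveUpTo-∸ (dipath-injective dp))
        (injectiveUpTo-∸ (dipath-colour-injective dp ≤-refl)) (adjacent-reverse p (λ k<χ′ → proj₁ (step dp k<χ′)))

    χ≤level⇒rainbow : ∀ {i x} → χ ≤ i → InLevel G χ c i x → RainbowPathFrom G χ c x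
    χ≤level⇒rainbow {suc j} {x} (s≤s χ′≤j) (x∉V≤j , _) =
      dipath⇒rainbow-from-start (dipath-take χ′≤j (proj₂ (¬below⇒dipath j x x∉V≤j)))

    module _ {s : V G} (unique : ∀ t → Sink G χ c t → t ≡ s) (surjective : ∀ t → ∃[ u ] c u ≡ t) where

      long-dipath-to-sink : ∃[ p ] IsDiPath χ′ p × p χ′ ≡ s
      long-dipath-to-sink with surjective (fromℕ< (m%n<n (suc (toℕ (c s))) χ))
      ... | u , cu≡t with below⇒dipath-to-sink unique _ u (below-n u)
      ...   | m , p , dp , end =
        (λ k → (u ◂ p) (m ∸ χ′ + k)) , dipath-drop (m ∸ χ′) dp′ , trans (cong (u ◂ p) m∸χ′+χ′≡m) end
        where
        open ≡-Reasoning
        χ′≤m : χ′ ≤ m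
        χ′≤m = ≤-pred (∣⇒≤ (dipath-length dp (begin
          toℕ (c u)                   ≡⟨ cong toℕ cu≡t ⟩
          toℕ (fromℕ< _)              ≡⟨ Fin.toℕ-fromℕ< _ ⟩
          suc (toℕ (c s)) % χ         ≡⟨ cong (λ v → suc (toℕ (c v)) % χ) end ⟨
          suc (toℕ (c ((u ◂ p) m))) % χ ∎)))
        m∸χ′+χ′≡m : m ∸ χ′ + χ′ ≡ m
        m∸χ′+χ′≡m = m∸n+n≡m χ′≤m
        dp′ : IsDiPath (m ∸ χ′ + χ′) (u ◂ p)
        dp′ = subst (λ l → IsDiPath l (u ◂ p)) (sym m∸χ′+χ′≡m) dp

      sink⇒rainbow : ∀ {x} → Sink G χ c x → RainbowPathFrom G χ c x
      sink⇒rainbow {x} x-sink with long-dipath-to-sink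
      ... | p , dp , end = subst (RainbowPathFrom G χ c) (trans end (sym (unique x x-sink)))
                             (dipath⇒rainbow-from-end dp)

lemma4 : (G : Graph) → Connected G → (χ : ℕ) → IsChromaticNumber G χ →
    (c : V G → Fin χ) → Nice G χ c →
    (x : V G) → InB G χ c x →
    ∃[ i ] (2 ≤ i × i ≤ χ ∸ 1 × InLevel G χ c i x)
lemma4 G _ zero _ c _ x _ with c x
... | ()
lemma4 G _ (suc χ′) (_ , minimal) c (proper , acyclic , _ , _ , unique) x x∈B
  with below⇒inLevel G c _ x (below-n G c acyclic x)
... | suc zero , (_ , x-sink) =
  ⊥-elim (x∈B (sink⇒rainbow G c acyclic unique (colour-surjective G c proper minimal) x-sink))
... | i@(suc (suc _)) , x∈Vi with i ≤? χ′
...   | yes i≤χ′ = i , s≤s (s≤s z≤n) , i≤χ′ , x∈Vi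
...   | no i≰χ′ = ⊥-elim (x∈B (χ≤level⇒rainbow G c acyclic (≰⇒> i≰χ′) x∈Vi))
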